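{- Let $G_1$ and $G_2$ be regular graphs of orders $n_1,n_2$ and regularities $r_1,r_2$ respectively, each containing a clique of order $k$, and let $G=G_1\circ_k G_2$. Then the maximum degree of $G$ is $\Delta(G)=r_1+r_2-k+1$. Moreover, if $k=n_1$ or $k=n_2$, then the minimum degree is $\delta(G)=\max\{r_1,r_2\}$, and if $k<n_1$ and $k<n_2$, then $\delta(G)=\min\{r_1,r_2\}$.
   Context: All graphs are finite and simple. For graphs $G_1,G_2$ each containing a clique of order $k$, the $k$-coalescence $G_1\circ_k G_2$ is the graph obtained by choosing a $k$-clique in $G_1$ and a $k$-clique in $G_2$ and identifying (merging) these two cliques vertex by vertex; it has $n_1+n_2-k$ vertices and $m_1+m_2-\frac{k(k-1)}{2}$ edges, where $n_i,m_i$ are the order and size of $G_i$. $\Delta$ and $\delta$ denote maximum and minimum degree. -}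

module Defs where

open import Data.Nat using (ℕ; zero; suc; _+_; _⊔_; _⊓_)
open import Data.Bool using (Bool; true; false; if_then_else_)
open import Data.Fin using (Fin)
open import Data.List using (List; map; foldr)
open import Data.Nat.ListAction using (sum)
open import Data.List.Base using (allFin)
open import Data.Product using (Σ; _×_; ∃; ∃-syntax)
open import Data.Sum using (_⊎_)
open import Relation.Binary.PropositionalEquality using (_≡_; _≢_)
open import Function.Definitions using (Injective)

record Graph (n : ℕ) : Set where
  field
    adj    : Fin n → Fin n → Bool
    sym    : ∀ u v → adj u v ≡ adj v u
    irrefl : ∀ v → adj v v ≡ false
open Graph public

degree : ∀ {n} → Graph n → Fin n → ℕ
degree {n} G v = sum (map (λ u → if adj G v u then 1 else 0) (allFin n))

maxDegree : ∀ {n} → Graph n → ℕ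
maxDegree {n} G = foldr _⊔_ 0 (map (degree G) (allFin n))

minDegree : ∀ {n} → Graph n → ℕ
minDegree {zero}  G = 0
minDegree {suc n} G = foldr _⊓_ (degree G Data.Fin.zero) (map (degree G) (allFin (suc n)))


Regular : ∀ {n} → Graph n → ℕ → Set
Regular G r = ∀ v → degree G v ≡ r

IsClique : ∀ {n k} → Graph n → (Fin k → Fin n) → Set
IsClique G c = Injective _≡_ _≡_ c × (∀ i j → i ≢ j → adj G (c i) (c j) ≡ true)

-- G (on Fin N) is the k-coalescence of G1 and G2 obtained by identifying
-- the clique c1 of G1 with the clique c2 of G2 vertex by vertex
-- (c1 i ~ c2 i); f1, f2 are the embeddings of the vertex sets of G1, G2 into G.
record IsCoalescence {n1 n2 k N : ℕ} (G1 : Graph n1) (G2 : Graph n2)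
    (c1 : Fin k → Fin n1) (c2 : Fin k → Fin n2) (G : Graph N)
    (f1 : Fin n1 → Fin N) (f2 : Fin n2 → Fin N) : Set where
  field
    f1-inj   : Injective _≡_ _≡_ f1
    f2-inj   : Injective _≡_ _≡_ f2
    glue     : ∀ i → f1 (c1 i) ≡ f2 (c2 i)
    onlyClique : ∀ x y → f1 x ≡ f2 y → ∃[ i ] (x ≡ c1 i × y ≡ c2 i)
    cover    : ∀ v → (∃[ x ] f1 x ≡ v) ⊎ (∃[ y ] f2 y ≡ v)
    edge⇒    : ∀ u v → adj G u v ≡ true →
               (∃[ x ] ∃[ y ] (f1 x ≡ u × f1 y ≡ v × adj G1 x y ≡ true))
               ⊎ (∃[ x ] ∃[ y ] (f2 x ≡ u × f2 y ≡ v × adj G2 x y ≡ true))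
    edge⇐₁   : ∀ x y → adj G1 x y ≡ true → adj G (f1 x) (f1 y) ≡ true
    edge⇐₂   : ∀ x y → adj G2 x y ≡ true → adj G (f2 x) (f2 y) ≡ true

{-# OPTIONS --safe #-}
-- Every vertex of G = G₁ ∘ₖ G₂ is either a non-clique vertex of one Gᵢ, which keeps its
-- degree rᵢ, or a glued clique vertex. A glued vertex keeps its r₁ neighbours from G₁ and
-- gains its neighbours in G₂ off the clique; in G₂ it has k - 1 neighbours on the clique,
-- hence r₂ - (k - 1) off it, so its degree is r₁ + r₂ - k + 1 ≥ max(r₁, r₂). The extreme
-- degrees then depend only on which of the three kinds of vertices exist, and non-clique
-- vertices of Gᵢ exist exactly when k < nᵢ.
module Submission where

open import Defs
open import Data.Nat using (ℕ; suc; _+_; _∸_; _≤_; _<_; _⊔_; _⊓_; z≤n; s≤s)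
open import Data.Nat.Properties hiding (_≟_)
open import Data.Nat.ListAction using (sum)
open import Data.Nat.ListAction.Properties using (sum-++; sum-↭)
open import Data.Bool using (Bool; true; false; if_then_else_)
open import Data.Bool.Properties using (⇔→≡; ¬-not)
open import Data.Fin as Fin using (Fin; fromℕ<)
open import Data.Fin.Properties using (any?; _≟_)
open import Data.List using (List; []; _∷_; map; _++_; filter; length; allFin)
open import Data.List.Properties
  using (map-++; map-∘; map-cong; length-tabulate; foldr-preservesᵇ; foldr-forcesᵇ)
open import Data.List.Membership.Propositional using (_∈_)
open import Data.List.Membership.Propositional.Properties
  using (∈-allFin; ∈-filter⁺; ∈-filter⁻; ∈-map⁺; ∈-map⁻; ∈-++⁺ˡ; ∈-++⁺ʳ)
open import Data.List.Membership.Propositional.Properties.WithK using (unique∧set⇒bag)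
open import Data.List.Relation.Binary.BagAndSetEquality using (∼bag⇒↭)
open import Data.List.Relation.Binary.Permutation.Propositional using (_↭_)
import Data.List.Relation.Binary.Permutation.Propositional.Properties as ↭
open import Data.List.Relation.Unary.All as All using (All; []; _∷_)
open import Data.List.Relation.Unary.All.Properties as All using ()
open import Data.List.Relation.Unary.Any using (here)
open import Data.List.Relation.Unary.Unique.Propositional using (Unique)
import Data.List.Relation.Unary.Unique.Propositional.Properties as Unique
open import Data.Product using (∃-syntax; _×_; _,_; proj₁; proj₂)
open import Data.Sum as Sum using (_⊎_; inj₁; inj₂)
open import Data.Empty using (⊥-elim)
open import Function using (_∘_; id; const)
open import Function.Bundles using (mk⇔)
open import Function.Definitions using (Injective)
open import Relation.Nullary using (¬_; yes; no)
open import Relation.Nullary.Decidable using (¬?)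
open import Relation.Unary using (Decidable)
import Relation.Binary.PropositionalEquality as ≡
open ≡ using (_≡_; refl; trans; cong; cong₂; subst; subst₂; module ≡-Reasoning)

private
  variable
    A B : Set
    n₁ n₂ k N : ℕ
    G₁ : Graph n₁
    G₂ : Graph n₂
    c₁ : Fin k → Fin n₁
    c₂ : Fin k → Fin n₂
    G : Graph N
    f₁ : Fin n₁ → Fin N
    f₂ : Fin n₂ → Fin N

-- Shaped so that degree G v is definitionally count (adj G v) (allFin n).
count : (A → Bool) → List A → ℕ
count P xs = sum (map (λ x → if P x then 1 else 0) xs)

count-++ : (P : A → Bool) (xs ys : List A) → count P (xs ++ ys) ≡ count P xs + count P ys
count-++ P xs ys = trans (cong sum (map-++ _ xs ys)) (sum-++ (map _ xs) (map _ ys))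

count-map : (P : B → Bool) (f : A → B) (xs : List A) → count P (map f xs) ≡ count (P ∘ f) xs
count-map P f xs = cong sum (≡.sym (map-∘ xs))

count-cong : {P Q : A → Bool} → (∀ x → P x ≡ Q x) →
             (xs : List A) → count P xs ≡ count Q xs
count-cong P≗Q = cong sum ∘ map-cong (λ x → cong (λ b → if b then 1 else 0) (P≗Q x))

count-true : {P : A → Bool} {xs : List A} →
             All (λ x → P x ≡ true) xs → count P xs ≡ length xs
count-true []           = refl
count-true (Px ∷ Pxs) rewrite Px = cong suc (count-true Pxs)

count-const-true : (xs : List A) → count (const true) xs ≡ length xs
count-const-true xs = count-true (All.universal (λ _ → refl) xs)

count-false : {P : A → Bool} {xs : List A} →
              All (λ x → P x ≡ false) xs → count P xs ≡ 0
count-false []           = refl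
count-false (Px ∷ Pxs) rewrite Px = count-false Pxs

count≤length : (P : A → Bool) (xs : List A) → count P xs ≤ length xs
count≤length P []       = z≤n
count≤length P (x ∷ xs) with P x
... | true  = s≤s (count≤length P xs)
... | false = m≤n⇒m≤1+n (count≤length P xs)

count-↭ : (P : A → Bool) {xs ys : List A} → xs ↭ ys → count P xs ≡ count P ys
count-↭ P = sum-↭ ∘ ↭.map⁺ _

count-allFin : ∀ {n} (P : Fin n → Bool) {xs : List (Fin n)} →
               Unique xs → (∀ v → v ∈ xs) → count P (allFin n) ≡ count P xs
count-allFin {n} P unique every =
  count-↭ P (∼bag⇒↭ (unique∧set⇒bag (Unique.allFin⁺ n) unique
                                    (mk⇔ (λ _ → every _) (λ _ → ∈-allFin _))))

length-allFin : ∀ n → length (allFin n) ≡ n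
length-allFin n = length-tabulate id

module _ {k n} (c : Fin k → Fin n) where

  InImage : Fin n → Set
  InImage x = ∃[ j ] c j ≡ x

  inImage? : Decidable InImage
  inImage? x = any? (λ j → c j ≟ x)

  outside : List (Fin n)
  outside = filter (¬? ∘ inImage?) (allFin n)

  ∈-outside⁺ : ∀ {x} → ¬ InImage x → x ∈ outside
  ∈-outside⁺ = ∈-filter⁺ (¬? ∘ inImage?) (∈-allFin _)

  ∈-outside⁻ : ∀ {x} → x ∈ outside → ¬ InImage x
  ∈-outside⁻ = proj₂ ∘ ∈-filter⁻ (¬? ∘ inImage?) {xs = allFin n}

  unique-outside : Unique outside
  unique-outside = Unique.filter⁺ (¬? ∘ inImage?) (Unique.allFin⁺ n)

count-split : ∀ {m p k N} {f : Fin m → Fin N} {g : Fin p → Fin N} {h : Fin k → Fin p} →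
  Injective _≡_ _≡_ f → Injective _≡_ _≡_ g →
  (∀ a b → f a ≡ g b → InImage h b) →
  (∀ v → (∃[ a ] f a ≡ v) ⊎ (∃[ b ] ¬ InImage h b × g b ≡ v)) →
  (P : Fin N → Bool) →
  count P (allFin N) ≡ count (P ∘ f) (allFin m) + count (P ∘ g) (outside h)
count-split {m} {N = N} {f} {g} {h} f-inj g-inj meet cover P = begin
  count P (allFin N)       ≡⟨ count-allFin P unique every ⟩
  count P (fs ++ gs)       ≡⟨ count-++ P fs gs ⟩
  count P fs + count P gs  ≡⟨ cong₂ _+_ (count-map P f (allFin m)) (count-map P g (outside h)) ⟩
  count (P ∘ f) (allFin m) + count (P ∘ g) (outside h) ∎
  where
  open ≡-Reasoning
  fs gs : List (Fin N)
  fs = map f (allFin m)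
  gs = map g (outside h)

  disjoint : ∀ {v} → ¬ (v ∈ fs × v ∈ gs)
  disjoint (v∈fs , v∈gs) with ∈-map⁻ f v∈fs | ∈-map⁻ g v∈gs
  ... | a , _ , refl | b , b∈ , fa≡gb = ∈-outside⁻ h b∈ (meet a b fa≡gb)

  unique : Unique (fs ++ gs)
  unique = Unique.++⁺ (Unique.map⁺ f-inj (Unique.allFin⁺ m))
                      (Unique.map⁺ g-inj (unique-outside h)) disjoint

  every : ∀ v → v ∈ fs ++ gs
  every v with cover v
  ... | inj₁ (a , refl)         = ∈-++⁺ˡ (∈-map⁺ f (∈-allFin a))
  ... | inj₂ (b , ¬img , refl) = ∈-++⁺ʳ fs (∈-map⁺ g (∈-outside⁺ h ¬img))

module _ {k n} {c : Fin k → Fin n} (c-inj : Injective _≡_ _≡_ c) where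

  count-image-outside : (P : Fin n → Bool) →
                        count P (allFin n) ≡ count (P ∘ c) (allFin k) + count P (outside c)
  count-image-outside = count-split c-inj id (λ a b e → a , e) cover
    where
    cover : ∀ v → InImage c v ⊎ (∃[ b ] ¬ InImage c b × b ≡ v)
    cover v with inImage? c v
    ... | yes img = inj₁ img
    ... | no ¬img = inj₂ (v , ¬img , refl)

  length-outside : n ≡ k + length (outside c)
  length-outside = begin
    n                                    ≡⟨ length-allFin n ⟨
    length (allFin n)                    ≡⟨ count-const-true (allFin n) ⟨
    count (const true) (allFin n)        ≡⟨ count-image-outside (const true) ⟩
    count (const true) (allFin k) + count (const true) (outside c)
      ≡⟨ cong₂ _+_ (trans (count-const-true (allFin k)) (length-allFin k))
                   (count-const-true (outside c)) ⟩
    k + length (outside c)               ∎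
    where open ≡-Reasoning

  ∃-outside : k < n → ∃[ x ] ¬ InImage c x
  ∃-outside k<n with outside c | ∈-outside⁻ c | length-outside
  ... | []    | _       | n≡k+0 = ⊥-elim (<-irrefl (≡.sym (trans n≡k+0 (+-identityʳ k))) k<n)
  ... | x ∷ _ | ∉-image | _     = x , ∉-image (here refl)

  length-outside≡0 : k ≡ n → length (outside c) ≡ 0
  length-outside≡0 k≡n =
    +-cancelˡ-≡ k _ 0 (trans (≡.sym (trans k≡n length-outside)) (≡.sym (+-identityʳ k)))

  count-outside≡0 : k ≡ n → (P : Fin n → Bool) → count P (outside c) ≡ 0
  count-outside≡0 k≡n P =
    n≤0⇒n≡0 (subst (count P (outside c) ≤_) (length-outside≡0 k≡n) (count≤length P (outside c)))

  InImage-all : k ≡ n → ∀ x → InImage c x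
  InImage-all k≡n x with inImage? c x
  ... | yes img = img
  ... | no ¬img with outside c | ∈-outside⁺ c ¬img | length-outside≡0 k≡n
  ...   | []    | ()   | _
  ...   | _ ∷ _ | _    | ()

+-∸-suc : ∀ a {b k t} → suc b ≡ k + t → a + t ≡ a + b + 1 ∸ k
+-∸-suc a {b} {k} {t} suc-b≡k+t = begin
  a + t             ≡⟨ m+n∸m≡n k (a + t) ⟨
  k + (a + t) ∸ k   ≡⟨ cong (_∸ k) (+-comm k (a + t)) ⟩
  a + t + k ∸ k     ≡⟨ cong (_∸ k) (+-assoc a t k) ⟩
  a + (t + k) ∸ k   ≡⟨ cong (λ s → a + s ∸ k) (trans (+-comm t k) (≡.sym suc-b≡k+t)) ⟩
  a + suc b ∸ k     ≡⟨ cong (λ s → a + s ∸ k) (+-comm 1 b) ⟩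
  a + (b + 1) ∸ k   ≡⟨ cong (_∸ k) (+-assoc a b 1) ⟨
  a + b + 1 ∸ k     ∎
  where open ≡-Reasoning

module _ {n k} {G : Graph n} {c : Fin k → Fin n} (clique : IsClique G c) where

  suc-count-adj-clique : ∀ i → suc (count (λ j → adj G (c i) (c j)) (allFin k)) ≡ k
  suc-count-adj-clique i = begin
    suc (count Q (allFin k))
      ≡⟨ cong suc (count-image-outside single-inj Q) ⟩
    suc ((if Q i then 1 else 0) + 0 + count Q (outside single))
      ≡⟨ cong (λ b → suc ((if b then 1 else 0) + 0 + count Q (outside single))) (irrefl G (c i)) ⟩
    suc (count Q (outside single))
      ≡⟨ cong suc (count-true (All.tabulate adjacent)) ⟩
    suc (length (outside single))
      ≡⟨ length-outside single-inj ⟨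
    k ∎
    where
    open ≡-Reasoning
    Q : Fin k → Bool
    Q j = adj G (c i) (c j)
    single : Fin 1 → Fin k
    single = const i
    single-inj : Injective _≡_ _≡_ single
    single-inj {Fin.zero} {Fin.zero} _ = refl
    adjacent : ∀ {j} → j ∈ outside single → Q j ≡ true
    adjacent j∈ = proj₂ clique i _ (λ i≡j → ∈-outside⁻ single j∈ (Fin.zero , i≡j))

  degree-clique : ∀ i → suc (degree G (c i)) ≡ k + count (adj G (c i)) (outside c)
  degree-clique i = trans (cong suc (count-image-outside (proj₁ clique) (adj G (c i))))
                          (cong (_+ count (adj G (c i)) (outside c)) (suc-count-adj-clique i))


IsCoalescence-swap : IsCoalescence G₁ G₂ c₁ c₂ G f₁ f₂ → IsCoalescence G₂ G₁ c₂ c₁ G f₂ f₁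
IsCoalescence-swap C = record
  { f1-inj     = f2-inj
  ; f2-inj     = f1-inj
  ; glue       = ≡.sym ∘ glue
  ; onlyClique = λ x y e → let (i , y≡ , x≡) = onlyClique y x (≡.sym e) in i , x≡ , y≡
  ; cover      = Sum.swap ∘ cover
  ; edge⇒      = λ u v → Sum.swap ∘ edge⇒ u v
  ; edge⇐₁     = edge⇐₂
  ; edge⇐₂     = edge⇐₁
  }
  where open IsCoalescence C

module Embedding
  {n₁ n₂ k N} {G₁ : Graph n₁} {G₂ : Graph n₂} {c₁ : Fin k → Fin n₁} {c₂ : Fin k → Fin n₂}
  {G : Graph N} {f₁ : Fin n₁ → Fin N} {f₂ : Fin n₂ → Fin N}
  (clique₁ : IsClique G₁ c₁) (C : IsCoalescence G₁ G₂ c₁ c₂ G f₁ f₂) where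
  open IsCoalescence C

  adj-f₁ : ∀ x y → adj G (f₁ x) (f₁ y) ≡ adj G₁ x y
  adj-f₁ x y = ⇔→≡ (mk⇔ from-G (edge⇐₁ x y))
    where
    -- An edge of G₂ between glued vertices joins distinct clique vertices, hence is one of G₁.
    from-G : adj G (f₁ x) (f₁ y) ≡ true → adj G₁ x y ≡ true
    from-G e with edge⇒ _ _ e
    ... | inj₁ (x′ , y′ , f₁x′≡ , f₁y′≡ , e₁) rewrite f1-inj f₁x′≡ | f1-inj f₁y′≡ = e₁
    ... | inj₂ (x′ , y′ , f₂x′≡ , f₂y′≡ , e₂)
          with onlyClique x x′ (≡.sym f₂x′≡) | onlyClique y y′ (≡.sym f₂y′≡)
    ...   | i , refl , refl | j , refl , refl with i ≟ j
    ...     | yes refl with () ← trans (≡.sym e₂) (irrefl G₂ (c₂ i))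
    ...     | no i≢j   = proj₂ clique₁ i j i≢j

  cross-edge : ∀ x y → adj G (f₁ x) (f₂ y) ≡ true → InImage c₁ x ⊎ InImage c₂ y
  cross-edge x y e with edge⇒ _ _ e
  ... | inj₁ (_ , y′ , _ , f₁y′≡ , _) =
    let (j , _ , y≡) = onlyClique y′ y f₁y′≡ in inj₂ (j , ≡.sym y≡)
  ... | inj₂ (x′ , _ , f₂x′≡ , _ , _) =
    let (j , x≡ , _) = onlyClique x x′ (≡.sym f₂x′≡) in inj₁ (j , ≡.sym x≡)

module Coalescence
  {n₁ n₂ k N} {G₁ : Graph n₁} {G₂ : Graph n₂} {c₁ : Fin k → Fin n₁} {c₂ : Fin k → Fin n₂}
  {G : Graph N} {f₁ : Fin n₁ → Fin N} {f₂ : Fin n₂ → Fin N}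
  (clique₁ : IsClique G₁ c₁) (clique₂ : IsClique G₂ c₂)
  (C : IsCoalescence G₁ G₂ c₁ c₂ G f₁ f₂) where
  open IsCoalescence C
  open Embedding clique₁ C
  open Embedding clique₂ (IsCoalescence-swap C) using () renaming (adj-f₁ to adj-f₂)

  count-coalescence : (P : Fin N → Bool) →
    count P (allFin N) ≡ count (P ∘ f₁) (allFin n₁) + count (P ∘ f₂) (outside c₂)
  count-coalescence = count-split f1-inj f2-inj meet cover′
    where
    meet : ∀ a b → f₁ a ≡ f₂ b → InImage c₂ b
    meet a b e = let (j , _ , b≡) = onlyClique a b e in j , ≡.sym b≡
    cover′ : ∀ v → (∃[ a ] f₁ a ≡ v) ⊎ (∃[ b ] ¬ InImage c₂ b × f₂ b ≡ v)
    cover′ v with cover v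
    ... | inj₁ from-G₁      = inj₁ from-G₁
    ... | inj₂ (y , f₂y≡v) with inImage? c₂ y
    ...   | yes (j , refl) = inj₁ (c₁ j , trans (glue j) f₂y≡v)
    ...   | no ¬img        = inj₂ (y , ¬img , f₂y≡v)

  degree-f₁-outside : ∀ x → ¬ InImage c₁ x → degree G (f₁ x) ≡ degree G₁ x
  degree-f₁-outside x ¬img = begin
    degree G (f₁ x)
      ≡⟨ count-coalescence (adj G (f₁ x)) ⟩
    count (adj G (f₁ x) ∘ f₁) (allFin n₁) + count (adj G (f₁ x) ∘ f₂) (outside c₂)
      ≡⟨ cong₂ _+_ (count-cong (adj-f₁ x) (allFin n₁))
                   (count-false (All.tabulate no-cross-edge)) ⟩
    degree G₁ x + 0
      ≡⟨ +-identityʳ _ ⟩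
    degree G₁ x ∎
    where
    open ≡-Reasoning
    no-cross-edge : ∀ {y} → y ∈ outside c₂ → adj G (f₁ x) (f₂ y) ≡ false
    no-cross-edge y∈ = ¬-not (Sum.[ ¬img , ∈-outside⁻ c₂ y∈ ] ∘ cross-edge x _)

  degree-glued : ∀ i →
    degree G (f₁ (c₁ i)) ≡ degree G₁ (c₁ i) + count (adj G₂ (c₂ i)) (outside c₂)
  degree-glued i = trans (count-coalescence (adj G (f₁ (c₁ i))))
    (cong₂ _+_ (count-cong (adj-f₁ (c₁ i)) (allFin n₁)) (count-cong adj-glued (outside c₂)))
    where
    adj-glued : ∀ y → adj G (f₁ (c₁ i)) (f₂ y) ≡ adj G₂ (c₂ i) y
    adj-glued y = trans (cong (λ w → adj G w (f₂ y)) (glue i)) (adj-f₂ (c₂ i) y)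

  data Origin : Fin N → Set where
    from₁ : ∀ x → ¬ InImage c₁ x → Origin (f₁ x)
    from₂ : ∀ y → ¬ InImage c₂ y → Origin (f₂ y)
    glued : ∀ i → Origin (f₁ (c₁ i))

  origin : ∀ v → Origin v
  origin v with cover v
  ... | inj₁ (x , refl) with inImage? c₁ x
  ...   | yes (i , refl) = glued i
  ...   | no ¬img        = from₁ x ¬img
  origin v | inj₂ (y , refl) with inImage? c₂ y
  ...   | yes (i , refl) = subst Origin (glue i) (glued i)
  ...   | no ¬img        = from₂ y ¬img

degree≤maxDegree : (G : Graph N) (v : Fin N) → degree G v ≤ maxDegree G
degree≤maxDegree {N} G v = All.lookup (All.map⁻ below-max) (∈-allFin v)
  where
  below-max : All (_≤ maxDegree G) (map (degree G) (allFin N))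
  below-max = foldr-forcesᵇ (λ x y x⊔y≤ → m⊔n≤o⇒m≤o x y x⊔y≤ , m⊔n≤o⇒n≤o x y x⊔y≤)
                            0 _ ≤-refl

minDegree≤degree : (G : Graph N) (v : Fin N) → minDegree G ≤ degree G v
minDegree≤degree {suc n} G v = All.lookup (All.map⁻ above-min) (∈-allFin v)
  where
  above-min : All (minDegree G ≤_) (map (degree G) (allFin (suc n)))
  above-min = foldr-forcesᵇ (λ x y ≤x⊓y → m≤n⊓o⇒m≤n x y ≤x⊓y , m≤n⊓o⇒m≤o x y ≤x⊓y)
                            _ _ ≤-refl

maxDegree-≡ : ∀ {d} (G : Graph N) →
              (∀ v → degree G v ≤ d) → ∃[ v ] degree G v ≡ d → maxDegree G ≡ d
maxDegree-≡ {N} G bounded (v , attained) = ≤-antisym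
  (foldr-preservesᵇ {P = _≤ _} ⊔-lub z≤n (All.map⁺ (All.universal bounded (allFin N))))
  (subst (_≤ maxDegree G) attained (degree≤maxDegree G v))

minDegree-≡ : ∀ {d} (G : Graph N) →
              (∀ v → d ≤ degree G v) → ∃[ v ] degree G v ≡ d → minDegree G ≡ d
minDegree-≡ {suc n} G bounded (v , attained) = ≤-antisym
  (subst (minDegree G ≤_) attained (minDegree≤degree G v))
  (foldr-preservesᵇ {P = _ ≤_} ⊓-glb (bounded Fin.zero)
                    (All.map⁺ (All.universal bounded (allFin (suc n)))))

module RegularCoalescence
  {n₁ n₂ k N r₁ r₂} {G₁ : Graph n₁} {G₂ : Graph n₂} {c₁ : Fin k → Fin n₁} {c₂ : Fin k → Fin n₂}
  {G : Graph N} {f₁ : Fin n₁ → Fin N} {f₂ : Fin n₂ → Fin N}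
  (regular₁ : Regular G₁ r₁) (regular₂ : Regular G₂ r₂)
  (clique₁ : IsClique G₁ c₁) (clique₂ : IsClique G₂ c₂)
  (C : IsCoalescence G₁ G₂ c₁ c₂ G f₁ f₂) where

  open IsCoalescence C using (glue)
  open Coalescence clique₁ clique₂ C
  private module Swapped = Coalescence clique₂ clique₁ (IsCoalescence-swap C)

  degree-from₁ : ∀ x → ¬ InImage c₁ x → degree G (f₁ x) ≡ r₁
  degree-from₁ x ¬img = trans (degree-f₁-outside x ¬img) (regular₁ x)

  degree-from₂ : ∀ y → ¬ InImage c₂ y → degree G (f₂ y) ≡ r₂
  degree-from₂ y ¬img = trans (Swapped.degree-f₁-outside y ¬img) (regular₂ y)

  degree-glued₁ : ∀ i → degree G (f₁ (c₁ i)) ≡ r₁ + count (adj G₂ (c₂ i)) (outside c₂)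
  degree-glued₁ i = trans (degree-glued i) (cong (_+ _) (regular₁ (c₁ i)))

  degree-glued₂ : ∀ i → degree G (f₁ (c₁ i)) ≡ r₂ + count (adj G₁ (c₁ i)) (outside c₁)
  degree-glued₂ i = trans (cong (degree G) (glue i))
                          (trans (Swapped.degree-glued i) (cong (_+ _) (regular₂ (c₂ i))))

  degree-glued-regular : ∀ i → degree G (f₁ (c₁ i)) ≡ r₁ + r₂ + 1 ∸ k
  degree-glued-regular i = trans (degree-glued₁ i)
    (+-∸-suc r₁ (trans (cong suc (≡.sym (regular₂ (c₂ i)))) (degree-clique {G = G₂} clique₂ i)))

  r₁≤degree-glued : ∀ i → r₁ ≤ degree G (f₁ (c₁ i))
  r₁≤degree-glued i = subst (r₁ ≤_) (≡.sym (degree-glued₁ i)) (m≤m+n r₁ _)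

  r₂≤degree-glued : ∀ i → r₂ ≤ degree G (f₁ (c₁ i))
  r₂≤degree-glued i = subst (r₂ ≤_) (≡.sym (degree-glued₂ i)) (m≤m+n r₂ _)

  maxDegree-regular : Fin k → maxDegree G ≡ r₁ + r₂ + 1 ∸ k
  maxDegree-regular i₀ = maxDegree-≡ G bounded (f₁ (c₁ i₀) , degree-glued-regular i₀)
    where
    bounded : ∀ v → degree G v ≤ r₁ + r₂ + 1 ∸ k
    bounded v with origin v
    ... | from₁ x ¬img =
      subst₂ _≤_ (≡.sym (degree-from₁ x ¬img)) (degree-glued-regular i₀) (r₁≤degree-glued i₀)
    ... | from₂ y ¬img =
      subst₂ _≤_ (≡.sym (degree-from₂ y ¬img)) (degree-glued-regular i₀) (r₂≤degree-glued i₀)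
    ... | glued i      = ≤-reflexive (degree-glued-regular i)

  minDegree-regular-complete : Fin k → k ≡ n₁ → minDegree G ≡ r₁ ⊔ r₂
  minDegree-regular-complete i₀ k≡n₁ =
    trans (minDegree-≡ G (≤-reflexive ∘ ≡.sym ∘ degree≡r₂) (f₁ (c₁ i₀) , degree≡r₂ _))
          (≡.sym (m≤n⇒m⊔n≡n (subst (r₁ ≤_) (degree≡r₂ _) (r₁≤degree-glued i₀))))
    where
    degree≡r₂ : ∀ v → degree G v ≡ r₂
    degree≡r₂ v with origin v
    ... | from₁ x ¬img = ⊥-elim (¬img (InImage-all (proj₁ clique₁) k≡n₁ x))
    ... | from₂ y ¬img = degree-from₂ y ¬img
    ... | glued i      = trans (degree-glued₂ i)
      (trans (cong (r₂ +_) (count-outside≡0 (proj₁ clique₁) k≡n₁ _)) (+-identityʳ r₂))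

  minDegree-regular-proper : k < n₁ → k < n₂ → minDegree G ≡ r₁ ⊓ r₂
  minDegree-regular-proper k<n₁ k<n₂ = minDegree-≡ G bounded attained
    where
    bounded : ∀ v → r₁ ⊓ r₂ ≤ degree G v
    bounded v with origin v
    ... | from₁ x ¬img = subst (r₁ ⊓ r₂ ≤_) (≡.sym (degree-from₁ x ¬img)) (m⊓n≤m r₁ r₂)
    ... | from₂ y ¬img = subst (r₁ ⊓ r₂ ≤_) (≡.sym (degree-from₂ y ¬img)) (m⊓n≤n r₁ r₂)
    ... | glued i      = ≤-trans (m⊓n≤m r₁ r₂) (r₁≤degree-glued i)
    attained : ∃[ v ] degree G v ≡ r₁ ⊓ r₂
    attained with ⊓-sel r₁ r₂ | ∃-outside (proj₁ clique₁) k<n₁ | ∃-outside (proj₁ clique₂) k<n₂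
    ... | inj₁ ⊓≡r₁ | x , ¬img | _        = f₁ x , trans (degree-from₁ x ¬img) (≡.sym ⊓≡r₁)
    ... | inj₂ ⊓≡r₂ | _        | y , ¬img = f₂ y , trans (degree-from₂ y ¬img) (≡.sym ⊓≡r₂)

mainTheorem1 : ∀ {n1 n2 r1 r2 k : ℕ} (G1 : Graph n1) (G2 : Graph n2) →
    1 ≤ k → Regular G1 r1 → Regular G2 r2 →
    (c1 : Fin k → Fin n1) → IsClique G1 c1 →
    (c2 : Fin k → Fin n2) → IsClique G2 c2 →
    (G : Graph (n1 + n2 ∸ k)) (f1 : Fin n1 → Fin (n1 + n2 ∸ k)) (f2 : Fin n2 → Fin (n1 + n2 ∸ k)) →
    IsCoalescence G1 G2 c1 c2 G f1 f2 →
    (maxDegree G ≡ r1 + r2 + 1 ∸ k)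
    × ((k ≡ n1 ⊎ k ≡ n2) → minDegree G ≡ r1 ⊔ r2)
    × (k < n1 → k < n2 → minDegree G ≡ r1 ⊓ r2)
mainTheorem1 {r1 = r1} {r2} {k} G1 G2 1≤k regular₁ regular₂ c1 clique₁ c2 clique₂ G f1 f2 C =
    maxDegree-regular i₀
  , Sum.[ minDegree-regular-complete i₀
        , (λ k≡n₂ → trans (Swapped.minDegree-regular-complete i₀ k≡n₂) (⊔-comm r2 r1)) ]
  , minDegree-regular-proper
  where
  i₀ : Fin k
  i₀ = fromℕ< 1≤k
  open RegularCoalescence regular₁ regular₂ clique₁ clique₂ C
  module Swapped = RegularCoalescence regular₂ regular₁ clique₂ clique₁ (IsCoalescence-swap C)
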